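{- For any $k$ there exist process templates $A,B$ with $|B|=k$ and an $\mathrm{LTL}\setminus\mathsf{X}$ formula $h(A,B_1)$ such that, in disjunctive systems, $(A,B)^{(1,2|B|)} \models \mathsf{E}_{uncond}\, h(A,B_1)$ and $(A,B)^{(1,2|B|-1)} \not\models \mathsf{E}_{uncond}\, h(A,B_1)$.
   Context: A process template is $U=(Q_U,\mathrm{init}_U,\Sigma_U,\delta_U)$ with finite state set $Q_U$ containing initial state $\mathrm{init}_U$, finite input alphabet $\Sigma_U$, and guarded transition relation $\delta_U \subseteq Q_U \times \Sigma_U \times \mathcal{P}(Q_A \cup Q_B) \times Q_U$. $Q_A,Q_B$ are disjoint, as are $\Sigma_A,\Sigma_B$; $|B|=|Q_B|$. The system $(A,B)^{(1,n)}$ consists of one copy $A$ of template $A$ and $n$ copies $B_1,\dots,B_n$ of $B$ in interleaving composition, starting with all processes in their initial states. A local transition $(q,\sigma,g,q')$ of process $p$ is enabled in global state $s$ with global input $e$ if $s(p)=q$, $e(p)=\sigma$ and (disjunctive interpretation) some process $p'\neq p$ has $s(p')\in g$. Each global step moves exactly one process along an enabled local transition. A run is a maximal sequence of configurations $(s_t,e_t,p_t)$ from the initial state, $p_t$ being the moving process (a configuration with $\bot$ occurs exactly when all processes are disabled, ending the run), in which the input to a process changes only at moments at which that process moves. A run is unconditionally-fair if every process moves infinitely often. $h(A,B_1)$ is an LTL formula without next-time operator over atomic propositions from $Q_A\cup\Sigma_A$ and from $Q_B\cup\Sigma_B$ indexed by $B_1$. $(A,B)^{(1,n)}\models \mathsf{E}_{uncond}\,h$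 means some unconditionally-fair run of $(A,B)^{(1,n)}$ satisfies $h$. -}

module Defs where

open import Data.Nat using (ℕ; zero; suc; _≤_; _<_)
open import Data.Fin using (Fin; zero; suc)
open import Data.Product using (_×_; _,_; ∃; proj₁; proj₂)
open import Data.Sum using (_⊎_; inj₁; inj₂)
open import Data.Bool using (Bool; true)
open import Data.List using (List)
open import Data.List.Membership.Propositional using (_∈_)
open import Data.Empty using (⊥)
open import Relation.Binary.PropositionalEquality using (_≡_)
open import Relation.Nullary using (¬_)

-- Local transitions (q , σ , g , q') with guard g ⊆ Q_A ∪ Q_B,
-- a subset represented by its characteristic function.

LocalTrans : ℕ → ℕ → Set → Set
LocalTrans nQ nΣ G = Fin nQ × Fin nΣ × (G → Bool) × Fin nQ

-- A pair of process templates A, B. Q_A = Fin nQA, Σ_A = Fin nΣA,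
-- Q_B = Fin nQB, Σ_B = Fin nΣB; disjointness of Q_A,Q_B (Σ_A,Σ_B) is
-- realised by the disjoint union.  |B| = |Q_B| = nQB.
record Templates : Set where
  field
    nQA nΣA nQB nΣB : ℕ
    initA : Fin nQA
    initB : Fin nQB
    δA : List (LocalTrans nQA nΣA (Fin nQA ⊎ Fin nQB))
    δB : List (LocalTrans nQB nΣB (Fin nQA ⊎ Fin nQB))

-- Processes of (A,B)^(1,n): the single copy of A and B_1..B_n
-- (B_i is pB (i-1)).
data Proc (n : ℕ) : Set where
  pA : Proc n
  pB : Fin n → Proc n

data LTL (AP : Set) : Set where
  atom : AP → LTL AP
  ¬ₗ_  : LTL AP → LTL AP
  _∧ₗ_ : LTL AP → LTL AP → LTL AP
  _𝐔_  : LTL AP → LTL AP → LTL AP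

-- Semantics over an infinite trace (labelling L t a : "a holds at time t").
_,_⊨_ : {AP : Set} → (ℕ → AP → Set) → ℕ → LTL AP → Set
L , i ⊨ atom a = L i a
L , i ⊨ (¬ₗ φ) = ¬ (L , i ⊨ φ)
L , i ⊨ (φ ∧ₗ ψ) = (L , i ⊨ φ) × (L , i ⊨ ψ)
L , i ⊨ (φ 𝐔 ψ) =
  ∃ λ j → i ≤ j × (L , j ⊨ ψ) × (∀ k → i ≤ k → k < j → L , k ⊨ φ)

-- "process B_1 is in local state / reads input x": false if n = 0
B₁Is : {X : Set} (n : ℕ) → (Fin n → X) → X → Set
B₁Is zero    f x = ⊥
B₁Is (suc n) f x = f zero ≡ x

module _ (T : Templates) where
  open Templates T

  GState : ℕ → Set
  GState n = Fin nQA × (Fin n → Fin nQB)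

  GInput : ℕ → Set
  GInput n = Fin nΣA × (Fin n → Fin nΣB)

  loc : ∀ {n} → GState n → Proc n → Fin nQA ⊎ Fin nQB
  loc s pA     = inj₁ (proj₁ s)
  loc s (pB i) = inj₂ (proj₂ s i)

  GuardOK : ∀ {n} → GState n → Proc n → (Fin nQA ⊎ Fin nQB → Bool) → Set
  GuardOK s p g = ∃ λ p' → ¬ p' ≡ p × g (loc s p') ≡ true

  data Step {n : ℕ} (s : GState n) (e : GInput n) : Proc n → GState n → Set where
    stepA : ∀ {q σ g q' s'} → (q , σ , g , q') ∈ δA →
            proj₁ s ≡ q → proj₁ e ≡ σ → GuardOK s pA g →
            proj₁ s' ≡ q' → (∀ j → proj₂ s' j ≡ proj₂ s j) →
            Step s e pA s'
    stepB : ∀ {i q σ g q' s'} → (q , σ , g , q') ∈ δB →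
            proj₂ s i ≡ q → proj₂ e i ≡ σ → GuardOK s (pB i) g →
            proj₂ s' i ≡ q' → proj₁ s' ≡ proj₁ s →
            (∀ j → ¬ j ≡ i → proj₂ s' j ≡ proj₂ s j) →
            Step s e (pB i) s'

  -- infinite runs of (A,B)^(1,n)  (unconditionally-fair runs are infinite,
  -- and infinite sequences are automatically maximal)
  record Run (n : ℕ) : Set where
    field
      st  : ℕ → GState n
      inp : ℕ → GInput n
      mv  : ℕ → Proc n
      initialA : proj₁ (st 0) ≡ initA
      initialB : ∀ i → proj₂ (st 0) i ≡ initB
      step : ∀ t → Step (st t) (inp t) (mv t) (st (suc t))
      inputA : ∀ t → ¬ mv t ≡ pA → proj₁ (inp (suc t)) ≡ proj₁ (inp t)
      inputB : ∀ t i → ¬ mv t ≡ pB i → proj₂ (inp (suc t)) i ≡ proj₂ (inp t) i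

  UncondFair : ∀ {n} → Run n → Set
  UncondFair {n} r = ∀ (p : Proc n) t → ∃ λ t' → t ≤ t' × Run.mv r t' ≡ p

  data AP : Set where
    stateA  : Fin nQA → AP
    inputA  : Fin nΣA → AP
    stateB₁ : Fin nQB → AP
    inputB₁ : Fin nΣB → AP

  label : ∀ {n} → Run n → ℕ → AP → Set
  label r t (stateA q)  = proj₁ (Run.st r t) ≡ q
  label r t (inputA σ)  = proj₁ (Run.inp r t) ≡ σ
  label {n} r t (stateB₁ q) = B₁Is n (proj₂ (Run.st r t)) q
  label {n} r t (inputB₁ σ) = B₁Is n (proj₂ (Run.inp r t)) σ

  EUncond : ℕ → LTL AP → Set
  EUncond n h = ∃ λ (r : Run n) → UncondFair r × (label r , 0 ⊨ h)

-- A climbs 0 → 1 → ⋯ → k and resets to 0; its climb a → a+1 is guarded by a B in state a.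
-- A B may leave 0 once, for any other state, and otherwise only idles, which its guard permits only
-- beside another B in the same state.  Along a run no B state ever decreases, so in a fair run
-- the B states eventually freeze; from then on every B still idles infinitely often and so has
-- a twin in its state, while A, visiting all its states infinitely often, keeps each of the
-- states 0, …, k-1 occupied.  That needs 2k copies of B.  With exactly 2k copies, one twin pair
-- per state, a periodic schedule realises such a run.

module Submission where

open import Data.Bool using (Bool; true; false)
open import Data.Fin using (Fin; zero; suc; toℕ; fromℕ; fromℕ<; inject₁; opposite; remQuot; combine)
open import Data.Fin.Properties
  using (any?; injective⇒≤; combine-remQuot; remQuot-combine; toℕ<n; toℕ≤n; toℕ-injective;
         toℕ-fromℕ<; toℕ-fromℕ; toℕ-inject₁; 0≢1+n)
  renaming (_≟_ to _≟ᶠ_)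
open import Data.List using ([]; _∷_; map; _++_; allFin)
open import Data.List.Membership.Propositional using (_∈_)
open import Data.List.Membership.Propositional.Properties
  using (∈-map⁻; ∈-map⁺; ∈-++⁻; ∈-++⁺ˡ; ∈-++⁺ʳ; ∈-allFin)
open import Data.List.Relation.Unary.Any using (here)
open import Data.Nat
  using (ℕ; zero; suc; _≤_; _<_; _*_; _∸_; _+_; z≤n; s≤s; z<s; _≟_; _<?_; NonZero;
         _≤′_; ≤′-refl; ≤′-step)
open import Data.Nat.DivMod
  using (_%_; %-distribˡ-+; m%n%n≡m%n; [m+kn]%n≡m%n; m<n⇒m%n≡m; m%n<n; m%n≤m; n%n≡0)
open import Data.Nat.Properties
  using (≤-refl; ≤-reflexive; ≤-trans; ≤-antisym; ≤-pred; ≤-<-trans; <-≤-trans; <-trans;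
         <⇒≤; <⇒≢; <⇒≱; ≮⇒≥; ≤∧≢⇒<; ≤⇒≤′; m≤n⇒m<n∨m≡n; n≤1+n; m<n⇒m<1+n;
         m≤m*n; m≤m+n; m≤n+m; m<m+n; +-suc; +-monoʳ-<;
         ∸-monoʳ-<; m<n+o⇒m∸n<o; m+n∸m≡n; m≤n⇒m∸n≡0; m+[n∸m]≡n)
open import Data.Product using (_×_; _,_; ∃; ∃₂; proj₁; proj₂; uncurry)
open import Data.Sum using (_⊎_; inj₁; inj₂)
open import Effect.Monad using (RawMonad)
open import Function using (_∘_)
open import Level using (0ℓ)
open import Relation.Binary.PropositionalEquality
  using (_≡_; _≢_; refl; sym; trans; cong; subst; module ≡-Reasoning)
open import Relation.Nullary using (¬_; Dec; yes; no; ¬?; does)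
open import Relation.Nullary.Decidable using (_×-dec_; decidable-stable; dec-true)
open import Relation.Nullary.Negation using (¬¬-Monad; contradiction)
open import Relation.Unary using (Decidable)

open import Defs

-- Eventual stabilisation and recurrence hold only up to double negation; the lower bound
-- proves ⊥, so it can be argued in this monad.
open RawMonad (¬¬-Monad {0ℓ})

module _ {AP : Set} where

  -- The logic has no constant ⊤; ¬ (φ ∧ ¬ φ) stands in for it.
  taut : LTL AP → LTL AP
  taut φ = ¬ₗ (φ ∧ₗ (¬ₗ φ))

  infix 25 ◇_ □◇_

  ◇_ : LTL AP → LTL AP
  ◇ φ = taut φ 𝐔 φ

  □◇_ : LTL AP → LTL AP
  □◇ φ = ¬ₗ (◇ (¬ₗ (◇ φ)))

  ⋀ : ∀ {k} → (Fin (suc k) → LTL AP) → LTL AP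
  ⋀ {zero}  φ = φ zero
  ⋀ {suc k} φ = φ zero ∧ₗ ⋀ (λ a → φ (suc a))

  module _ (L : ℕ → AP → Set) where

    ⊨taut : ∀ i φ → L , i ⊨ taut φ
    ⊨taut i φ (holds , fails) = fails holds

    ⊨□◇⁺ : ∀ i φ → (∀ t → ∃ λ t′ → t ≤ t′ × L , t′ ⊨ φ) → L , i ⊨ □◇ φ
    ⊨□◇⁺ i φ often (t , _ , never , _) =
      let t′ , t≤t′ , φt′ = often t in never (t′ , t≤t′ , φt′ , λ k _ _ → ⊨taut k φ)

    ⊨□◇⁻ : ∀ i φ → L , i ⊨ □◇ φ → ∀ t → i ≤ t → ¬ ¬ ∃ λ t′ → t ≤ t′ × L , t′ ⊨ φ
    ⊨□◇⁻ i φ often t i≤t never =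
      often (t , i≤t , (λ (t′ , t≤t′ , φt′ , _) → never (t′ , t≤t′ , φt′)) ,
             λ k _ _ → ⊨taut k (¬ₗ (◇ φ)))

    ⊨⋀⁺ : ∀ {k} i (φ : Fin (suc k) → LTL AP) → (∀ a → L , i ⊨ φ a) → L , i ⊨ ⋀ φ
    ⊨⋀⁺ {zero}  i φ all = all zero
    ⊨⋀⁺ {suc k} i φ all = all zero , ⊨⋀⁺ i (λ a → φ (suc a)) (λ a → all (suc a))

    ⊨⋀⁻ : ∀ {k} i (φ : Fin (suc k) → LTL AP) → L , i ⊨ ⋀ φ → ∀ a → L , i ⊨ φ a
    ⊨⋀⁻ {zero}  i φ holds zero = holds
    ⊨⋀⁻ {suc k} i φ (holds , _) zero = holds
    ⊨⋀⁻ {suc k} i φ (_ , rest) (suc a) = ⊨⋀⁻ i (λ a → φ (suc a)) rest a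

StableFrom : {A : Set} → (ℕ → A) → ℕ → Set
StableFrom f t₀ = ∀ t → t₀ ≤ t → f t ≡ f t₀

StableFrom-≤ : ∀ {A : Set} {f : ℕ → A} {s t} → StableFrom f s → s ≤ t → StableFrom f t
StableFrom-≤ stable s≤t u t≤u = trans (stable u (≤-trans s≤t t≤u)) (sym (stable _ s≤t))

module _ {f : ℕ → ℕ} (stepwise : ∀ t → f t ≤ f (suc t)) where

  stepwise⇒mono : ∀ {s t} → s ≤ t → f s ≤ f t
  stepwise⇒mono s≤t = go (≤⇒≤′ s≤t)
    where
    go : ∀ {s t} → s ≤′ t → f s ≤ f t
    go ≤′-refl        = ≤-refl
    go (≤′-step s≤′t) = ≤-trans (go s≤′t) (stepwise _)

  -- Induction on the remaining room b ∸ f t₀, which drops at every increase.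
  eventuallyStable : ∀ {b} → (∀ t → f t ≤ b) → ∀ t₀ → ¬ ¬ ∃ λ t₁ → t₀ ≤ t₁ × StableFrom f t₁
  eventuallyStable {b} bounded t₀ = go (suc (b ∸ f t₀)) t₀ ≤-refl
    where
    go : ∀ d t₀ → b ∸ f t₀ < d → ¬ ¬ ∃ λ t₁ → t₀ ≤ t₁ × StableFrom f t₁
    go (suc d) t₀ room unstable = unstable (t₀ , ≤-refl , stable)
      where
      stable : StableFrom f t₀
      stable t t₀≤t = decidable-stable (f t ≟ f t₀) λ changed →
        go d t (≤-trans (∸-monoʳ-< (≤∧≢⇒< (stepwise⇒mono t₀≤t) (changed ∘ sym)) (bounded t))
                        (≤-pred room))
           (λ (t₁ , t≤t₁ , st) → unstable (t₁ , ≤-trans t₀≤t t≤t₁ , st))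

allEventuallyStable : ∀ {n b} (f : Fin n → ℕ → ℕ) →
                      (∀ i t → f i t ≤ f i (suc t)) → (∀ i t → f i t ≤ b) →
                      ∀ t₀ → ¬ ¬ ∃ λ t₁ → t₀ ≤ t₁ × ∀ i → StableFrom (f i) t₁
allEventuallyStable {zero}  f stepwise bounded t₀ = pure (t₀ , ≤-refl , λ ())
allEventuallyStable {suc n} f stepwise bounded t₀ = do
  t₁ , t₀≤t₁ , restStable ← allEventuallyStable (f ∘ suc) (stepwise ∘ suc) (bounded ∘ suc) t₀
  t₂ , t₁≤t₂ , headStable ← eventuallyStable (stepwise zero) (bounded zero) t₁
  pure (t₂ , ≤-trans t₀≤t₁ t₁≤t₂ ,
        λ { zero → headStable ; (suc i) → StableFrom-≤ (restStable i) t₁≤t₂ })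

firstEntry : ∀ {P : ℕ → Set} → Decidable P → ∀ {u v} → u ≤ v → ¬ P u → P v →
             ∃ λ s → u ≤ s × ¬ P s × P (suc s)
firstEntry P? {v = zero}  z≤n ¬Pu Pv = contradiction Pv ¬Pu
firstEntry P? {v = suc v} u≤v ¬Pu Pv with m≤n⇒m<n∨m≡n u≤v
... | inj₂ refl = contradiction Pv ¬Pu
... | inj₁ u<1+v with P? v
...   | no ¬Pv = v , ≤-pred u<1+v , ¬Pv , Pv
...   | yes Pv′ = firstEntry P? (≤-pred u<1+v) ¬Pu Pv′

[1+m]%n≡[1+m%n]%n : ∀ m n .{{_ : NonZero n}} → suc m % n ≡ suc (m % n) % n
[1+m]%n≡[1+m%n]%n m n = begin
  (1 + m) % n                   ≡⟨ %-distribˡ-+ 1 m n ⟩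
  (1 % n + m % n) % n           ≡⟨ cong (λ x → (1 % n + x) % n) (m%n%n≡m%n m n) ⟨
  (1 % n + m % n % n) % n       ≡⟨ %-distribˡ-+ 1 (m % n) n ⟨
  (1 + m % n) % n               ∎
  where open ≡-Reasoning

[1+m]%n≡1+[m%n] : ∀ m n .{{_ : NonZero n}} → suc (m % n) < n → suc m % n ≡ suc (m % n)
[1+m]%n≡1+[m%n] m n lt = trans ([1+m]%n≡[1+m%n]%n m n) (m<n⇒m%n≡m lt)

[1+m]%n≡0 : ∀ m n .{{_ : NonZero n}} → suc (m % n) ≡ n → suc m % n ≡ 0
[1+m]%n≡0 m n eq = trans ([1+m]%n≡[1+m%n]%n m n) (trans (cong (_% n) eq) (n%n≡0 n))

%-recurs : ∀ {r n} .{{_ : NonZero n}} → r < n → ∀ t → ∃ λ t′ → t ≤ t′ × t′ % n ≡ r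
%-recurs {r} {n} r<n t = r + t * n , ≤-trans (m≤m*n t n) (m≤n+m (t * n) r) ,
                         trans ([m+kn]%n≡m%n r t n) (m<n⇒m%n≡m r<n)

TwoInFibre : ∀ {n k} → (Fin n → Fin k) → Fin k → Set
TwoInFibre f j = ∃₂ λ p q → p ≢ q × f p ≡ j × f q ≡ j

twoInFibre? : ∀ {n k} (f : Fin n → Fin k) → Decidable (TwoInFibre f)
twoInFibre? f j = any? λ p → any? λ q → ¬? (p ≟ᶠ q) ×-dec (f p ≟ᶠ j) ×-dec (f q ≟ᶠ j)

twoInEveryFibre⇒2*k≤n : ∀ {n k} (f : Fin n → Fin k) → (∀ j → TwoInFibre f j) → 2 * k ≤ n
twoInEveryFibre⇒2*k≤n {n} {k} f twos = injective⇒≤ {f = pick ∘ remQuot {2} k} pick∘remQuot-injective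
  where
  pick : Fin 2 × Fin k → Fin n
  pick (zero  , j) = proj₁ (twos j)
  pick (suc _ , j) = proj₁ (proj₂ (twos j))

  picks-differ : ∀ j → pick (zero , j) ≢ pick (suc zero , j)
  picks-differ j = proj₁ (proj₂ (proj₂ (twos j)))

  f∘pick : ∀ b j → f (pick (b , j)) ≡ j
  f∘pick zero       j = proj₁ (proj₂ (proj₂ (proj₂ (twos j))))
  f∘pick (suc zero) j = proj₂ (proj₂ (proj₂ (proj₂ (twos j))))

  pick-injective : ∀ x y → pick x ≡ pick y → x ≡ y
  pick-injective (b , j) (c , l) eq with trans (sym (f∘pick b j)) (trans (cong f eq) (f∘pick c l))
  pick-injective (zero     , j) (zero     , .j) eq | refl = refl
  pick-injective (suc zero , j) (suc zero , .j) eq | refl = refl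
  pick-injective (zero     , j) (suc zero , .j) eq | refl = contradiction eq (picks-differ j)
  pick-injective (suc zero , j) (zero     , .j) eq | refl = contradiction (sym eq) (picks-differ j)

  pick∘remQuot-injective : ∀ {x y} → pick (remQuot {2} k x) ≡ pick (remQuot {2} k y) → x ≡ y
  pick∘remQuot-injective {x} {y} eq = begin
    x                                   ≡⟨ combine-remQuot {2} k x ⟨
    uncurry combine (remQuot {2} k x)   ≡⟨ cong (uncurry (combine {2}))
                                               (pick-injective (remQuot k x) (remQuot k y) eq) ⟩
    uncurry combine (remQuot {2} k y)   ≡⟨ combine-remQuot {2} k y ⟩
    y                                   ∎
    where open ≡-Reasoning

module Construction (m : ℕ) where

  k : ℕ
  k = suc m

  Q : Set
  Q = Fin (suc k) ⊎ Fin k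

  Guard : Set
  Guard = Q → Bool

  occupiedBy : Fin k → Guard
  occupiedBy ℓ (inj₁ _)  = false
  occupiedBy ℓ (inj₂ ℓ′) = does (ℓ ≟ᶠ ℓ′)

  isA isB : Guard
  isA (inj₁ _) = true
  isA (inj₂ _) = false
  isB (inj₁ _) = false
  isB (inj₂ _) = true

  stay : Fin k → LocalTrans k 1 Q
  stay ℓ = ℓ , zero , occupiedBy ℓ , ℓ

  leave : Fin m → LocalTrans k 1 Q
  leave j = zero , zero , isA , suc j

  climb : Fin k → LocalTrans (suc k) 1 Q
  climb a = inject₁ a , zero , occupiedBy a , suc a

  reset : LocalTrans (suc k) 1 Q
  reset = fromℕ k , zero , isB , zero

  templates : Templates
  templates = record
    { nQA = suc k ; nΣA = 1 ; nQB = k ; nΣB = 1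
    ; initA = zero ; initB = zero
    ; δA = map climb (allFin k) ++ reset ∷ []
    ; δB = map stay (allFin k) ++ map leave (allFin m) }

  open Templates templates using (δA; δB)

  everyAStateRecurs : LTL (AP templates)
  everyAStateRecurs = ⋀ λ a → □◇ atom (stateA a)

  stay∈δB : ∀ ℓ → stay ℓ ∈ δB
  stay∈δB ℓ = ∈-++⁺ˡ (∈-map⁺ stay (∈-allFin ℓ))

  leave∈δB : ∀ j → leave j ∈ δB
  leave∈δB j = ∈-++⁺ʳ (map stay (allFin k)) (∈-map⁺ leave (∈-allFin j))

  climb∈δA : ∀ a → climb a ∈ δA
  climb∈δA a = ∈-++⁺ˡ (∈-map⁺ climb (∈-allFin a))

  reset∈δA : reset ∈ δA
  reset∈δA = ∈-++⁺ʳ (map climb (allFin k)) (here refl)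

  ∈δB⁻ : ∀ {q σ g q′} → (q , σ , g , q′) ∈ δB →
         (q′ ≡ q × g ≡ occupiedBy q) ⊎ (q ≡ zero × ∃ λ j → q′ ≡ suc j)
  ∈δB⁻ t∈δB with ∈-++⁻ (map stay (allFin k)) t∈δB
  ... | inj₁ t∈stay  with ∈-map⁻ stay t∈stay
  ...   | _ , _ , refl = inj₁ (refl , refl)
  ∈δB⁻ t∈δB | inj₂ t∈leave with ∈-map⁻ leave t∈leave
  ...   | j , _ , refl = inj₂ (refl , j , refl)

  ∈δA⁻ : ∀ {q σ g q′} → (q , σ , g , q′) ∈ δA →
         (∃ λ a → g ≡ occupiedBy a × q′ ≡ suc a) ⊎ q′ ≡ zero
  ∈δA⁻ t∈δA with ∈-++⁻ (map climb (allFin k)) t∈δA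
  ... | inj₁ t∈climb with ∈-map⁻ climb t∈climb
  ...   | a , _ , refl = inj₁ (a , refl , refl)
  ∈δA⁻ t∈δA | inj₂ (here refl) = inj₂ refl

  module _ {n : ℕ} where

    occupiedBy⁻ : ∀ {s : GState templates n} {p ℓ} → GuardOK templates s p (occupiedBy ℓ) →
                  ∃ λ i → pB i ≢ p × proj₂ s i ≡ ℓ
    occupiedBy⁻ {s} {ℓ = ℓ} (pB i , i≢p , holds) with ℓ ≟ᶠ proj₂ s i
    ... | yes refl = i , i≢p , refl

    occupiedBy⁺ : ∀ {s : GState templates n} {p ℓ} i → pB i ≢ p → proj₂ s i ≡ ℓ →
                  GuardOK templates s p (occupiedBy ℓ)
    occupiedBy⁺ {ℓ = ℓ} i i≢p refl = pB i , i≢p , dec-true (ℓ ≟ᶠ ℓ) refl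

    step-monoB : ∀ {s e p s′} → Step templates {n} s e p s′ →
                 ∀ i → toℕ (proj₂ s i) ≤ toℕ (proj₂ s′ i)
    step-monoB (stepA _ _ _ _ _ B-frame) i = ≤-reflexive (cong toℕ (sym (B-frame i)))
    step-monoB (stepB {i = i₀} t∈δB sᵢ≡q _ _ s′ᵢ≡q′ _ B-frame) i with i ≟ᶠ i₀
    ... | no i≢i₀ = ≤-reflexive (cong toℕ (sym (B-frame i i≢i₀)))
    ... | yes refl with ∈δB⁻ t∈δB
    ...   | inj₁ (refl , _) = ≤-reflexive (cong toℕ (trans sᵢ≡q (sym s′ᵢ≡q′)))
    ...   | inj₂ (refl , _) = ≤-trans (≤-reflexive (cong toℕ sᵢ≡q)) z≤n

    step-enterA : ∀ {s e p s′ j} → Step templates {n} s e p s′ →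
                  proj₁ s ≢ suc j → proj₁ s′ ≡ suc j → ∃ λ i → proj₂ s i ≡ j
    step-enterA (stepA t∈δA _ _ guard s′≡q′ _) before after with ∈δA⁻ t∈δA
    ... | inj₂ refl = contradiction (trans (sym s′≡q′) after) λ ()
    ... | inj₁ (a , refl , refl) with trans (sym s′≡q′) after
    ...   | refl = let i , _ , sᵢ≡a = occupiedBy⁻ guard in i , sᵢ≡a
    step-enterA (stepB _ _ _ _ _ A-frame _) before after =
      contradiction (trans (sym A-frame) after) before

    step-idleB : ∀ {s e i s′} → Step templates {n} s e (pB i) s′ → proj₂ s′ i ≡ proj₂ s i →
                 ∃ λ i′ → i′ ≢ i × proj₂ s i′ ≡ proj₂ s i
    step-idleB (stepB t∈δB sᵢ≡q _ guard s′ᵢ≡q′ _ _) idle with ∈δB⁻ t∈δB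
    ... | inj₁ (refl , refl) = let i′ , i′≢i , sᵢ′≡q = occupiedBy⁻ guard in
                               i′ , i′≢i ∘ cong pB , trans sᵢ′≡q (sym sᵢ≡q)
    ... | inj₂ (refl , j , refl) = contradiction (trans (sym s′ᵢ≡q′) (trans idle sᵢ≡q)) λ ()

  -- Fewer than 2k copies of B

  module _ {n : ℕ} (r : Run templates n) where
    open Run r

    Frozen : ℕ → Set
    Frozen t₁ = ∀ i → StableFrom (λ t → proj₂ (st t) i) t₁

    eventuallyFrozen : ¬ ¬ ∃ Frozen
    eventuallyFrozen = do
      t₁ , _ , stable ← allEventuallyStable (λ i t → toℕ (proj₂ (st t) i))
                          (λ i t → step-monoB (step t) i) (λ i t → toℕ≤n (proj₂ (st t) i)) 0
      pure (t₁ , λ i t t₁≤t → toℕ-injective (stable i t t₁≤t))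

    frozen-twin : UncondFair templates r → ∀ {t₁} → Frozen t₁ →
                  ∀ i → ∃ λ i′ → i′ ≢ i × proj₂ (st t₁) i′ ≡ proj₂ (st t₁) i
    frozen-twin fair {t₁} frozen i with fair (pB i) t₁
    ... | t , t₁≤t , moves =
      let i′ , i′≢i , same = step-idleB (subst (λ p → Step templates (st t) (inp t) p (st (suc t)))
                                                moves (step t)) idle
      in i′ , i′≢i , (begin
        proj₂ (st t₁) i′  ≡⟨ frozen i′ t t₁≤t ⟨
        proj₂ (st t) i′   ≡⟨ same ⟩
        proj₂ (st t) i    ≡⟨ frozen i t t₁≤t ⟩
        proj₂ (st t₁) i   ∎)
      where
      open ≡-Reasoning
      idle : proj₂ (st (suc t)) i ≡ proj₂ (st t) i
      idle = trans (frozen i (suc t) (≤-trans t₁≤t (n≤1+n t))) (sym (frozen i t t₁≤t))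

    frozen-occupied : label templates r , 0 ⊨ everyAStateRecurs → ∀ {t₁} → Frozen t₁ →
                      ∀ j → ¬ ¬ ∃ λ i → proj₂ (st t₁) i ≡ j
    frozen-occupied sat {t₁} frozen j = do
      u , t₁≤u , atZero ← recurs zero t₁
      v , u≤v , atSucj ← recurs (suc j) u
      let s , u≤s , before , after = firstEntry (λ t → proj₁ (st t) ≟ᶠ suc j) u≤v
                                       (λ z≡sj → 0≢1+n (trans (sym atZero) z≡sj)) atSucj
          i , sᵢ≡j = step-enterA (step s) before after
      pure (i , trans (sym (frozen i s (≤-trans t₁≤u u≤s))) sᵢ≡j)
      where
      recurs : ∀ a t → ¬ ¬ ∃ λ t′ → t ≤ t′ × proj₁ (st t′) ≡ a
      recurs a t = ⊨□◇⁻ (label templates r) 0 (atom (stateA a))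
                     (⊨⋀⁻ (label templates r) 0 (λ a → □◇ atom (stateA a)) sat a) t z≤n

    frozen⇒2*k≤n : UncondFair templates r → label templates r , 0 ⊨ everyAStateRecurs →
                   ∀ {t₁} → Frozen t₁ → 2 * k ≤ n
    frozen⇒2*k≤n fair sat {t₁} frozen =
      twoInEveryFibre⇒2*k≤n (proj₂ (st t₁)) λ j → decidable-stable (twoInFibre? _ j) do
        i , sᵢ≡j ← frozen-occupied sat frozen j
        let i′ , i′≢i , same = frozen-twin fair frozen i
        pure (i′ , i , i′≢i , trans same sᵢ≡j , sᵢ≡j)

  noFairRunBelow : ∀ {n} → n < 2 * k → ¬ EUncond templates n everyAStateRecurs
  noFairRunBelow n<2k (r , fair , sat) =
    eventuallyFrozen r λ (_ , frozen) → <⇒≱ n<2k (frozen⇒2*k≤n r fair sat frozen)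

  -- A fair run with 2k copies of B

  -- In every period B_0, …, B_{2k-1} move in turn (B_p the first time from 0 to target p,
  -- afterwards idling beside its twin), and then A climbs from 0 to k and resets.
  period : ℕ
  period = 2 * k + suc k

  phase : ℕ → ℕ
  phase t = t % period

  2k<period : 2 * k < period
  2k<period = m<m+n (2 * k) z<s

  target : Fin (2 * k) → Fin k
  target p = proj₂ (remQuot {2} k p)

  twin : Fin (2 * k) → Fin (2 * k)
  twin p = combine (opposite (proj₁ (remQuot {2} k p))) (target p)

  target-twin : ∀ p → target (twin p) ≡ target p
  target-twin p = cong proj₂ (remQuot-combine (opposite (proj₁ (remQuot {2} k p))) (target p))

  twin≢ : ∀ p → twin p ≢ p
  twin≢ p twin≡p = opposite≢ (proj₁ (remQuot {2} k p)) (begin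
    opposite (proj₁ (remQuot k p))   ≡⟨ cong proj₁ (remQuot-combine _ (target p)) ⟨
    proj₁ (remQuot k (twin p))       ≡⟨ cong (proj₁ ∘ remQuot k) twin≡p ⟩
    proj₁ (remQuot k p)              ∎)
    where
    open ≡-Reasoning
    opposite≢ : (b : Fin 2) → opposite b ≢ b
    opposite≢ zero       ()
    opposite≢ (suc zero) ()

  bState : Fin (2 * k) → ℕ → Fin k
  bState p t with toℕ p <? t
  ... | yes _ = target p
  ... | no  _ = zero

  bState-moved : ∀ {p t} → toℕ p < t → bState p t ≡ target p
  bState-moved {p} {t} p<t with toℕ p <? t
  ... | yes _   = refl
  ... | no  p≮t = contradiction p<t p≮t

  bState-fresh : ∀ {p t} → t ≤ toℕ p → bState p t ≡ zero
  bState-fresh {p} {t} t≤p with toℕ p <? t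
  ... | yes p<t = contradiction t≤p (<⇒≱ p<t)
  ... | no  _   = refl

  bState-targetZero : ∀ {p t} → target p ≡ zero → bState p t ≡ zero
  bState-targetZero {p} {t} eq with toℕ p <? t
  ... | yes _ = eq
  ... | no  _ = refl

  bState-frame : ∀ {p t} → toℕ p ≢ t → bState p (suc t) ≡ bState p t
  bState-frame {p} {t} p≢t with toℕ p <? t | toℕ p <? suc t
  ... | yes _   | yes _     = refl
  ... | no  _   | no  _     = refl
  ... | yes p<t | no  p≮1+t = contradiction (m<n⇒m<1+n p<t) p≮1+t
  ... | no  p≮t | yes p<1+t = contradiction (≤∧≢⇒< (≤-pred p<1+t) p≢t) p≮t

  bState-settled : ∀ {t} → 2 * k ≤ t → ∀ p → bState p t ≡ target p
  bState-settled 2k≤t p = bState-moved (<-≤-trans (toℕ<n p) 2k≤t)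

  aState : ℕ → Fin (suc k)
  aState t = fromℕ< (m<n+o⇒m∸n<o (phase t) (2 * k) (m%n<n t period))

  aState-at : ∀ t d → phase t ≡ 2 * k + d → toℕ (aState t) ≡ d
  aState-at t d eq = trans (toℕ-fromℕ< _) (trans (cong (_∸ 2 * k) eq) (m+n∸m≡n (2 * k) d))

  aState-home : ∀ t → phase t ≤ 2 * k → aState t ≡ zero
  aState-home t le = toℕ-injective (trans (toℕ-fromℕ< _) (m≤n⇒m∸n≡0 le))

  state : ℕ → GState templates (2 * k)
  state t = aState t , λ p → bState p t

  input : GInput templates (2 * k)
  input = zero , λ _ → zero

  mover : ℕ → Proc (2 * k)
  mover t with phase t <? 2 * k
  ... | yes ph<2k = pB (fromℕ< ph<2k)
  ... | no  _     = pA

  StepAt : ℕ → Proc (2 * k) → Set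
  StepAt t p = Step templates (state t) input p (state (suc t))

  bTurn : ∀ t p → toℕ p ≡ phase t → StepAt t (pB p)
  bTurn t p p≡ph = ownMove (toℕ p <? t)
    where
    ph<2k : phase t < 2 * k
    ph<2k = subst (_< 2 * k) p≡ph (toℕ<n p)

    A-frame : aState (suc t) ≡ aState t
    A-frame = trans (aState-home (suc t) (≤-trans (≤-reflexive ph′≡1+ph) ph<2k))
                    (sym (aState-home t (<⇒≤ ph<2k)))
      where
      ph′≡1+ph : phase (suc t) ≡ suc (phase t)
      ph′≡1+ph = [1+m]%n≡1+[m%n] t period (≤-<-trans ph<2k 2k<period)

    others : ∀ q → q ≢ p → bState q (suc t) ≡ bState q t
    others q q≢p = bState-frame λ q≡t → q≢p (toℕ-injective (begin
      toℕ q    ≡⟨ q≡t ⟩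
      t        ≡⟨ m<n⇒m%n≡m (subst (_< period) q≡t (<-trans (toℕ<n q) 2k<period)) ⟨
      phase t  ≡⟨ p≡ph ⟨
      toℕ p    ∎))
      where open ≡-Reasoning

    move : ∀ {q g q′} → (q , zero , g , q′) ∈ δB → bState p t ≡ q →
           GuardOK templates (state t) (pB p) g → bState p (suc t) ≡ q′ → StepAt t (pB p)
    move t∈δB before guard after = stepB t∈δB before refl guard after A-frame others

    twinGuard : ∀ {ℓ} → bState (twin p) t ≡ ℓ → GuardOK templates (state t) (pB p) (occupiedBy ℓ)
    twinGuard = occupiedBy⁺ (twin p) (twin≢ p ∘ pB-injective)
      where
      pB-injective : ∀ {i j : Fin (2 * k)} → pB i ≡ pB j → i ≡ j
      pB-injective refl = refl

    firstMove : ∀ ℓ → target p ≡ ℓ → t ≡ toℕ p → StepAt t (pB p)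
    firstMove zero    p↦0   t≡p = move (stay∈δB zero) (bState-fresh {p} (≤-reflexive t≡p))
      (twinGuard (bState-targetZero {t = t} (trans (target-twin p) p↦0)))
      (trans (bState-moved (s≤s (≤-reflexive (sym t≡p)))) p↦0)
    firstMove (suc j) p↦1+j t≡p = move (leave∈δB j) (bState-fresh {p} (≤-reflexive t≡p))
      (pA , (λ ()) , refl)
      (trans (bState-moved (s≤s (≤-reflexive (sym t≡p)))) p↦1+j)

    ownMove : Dec (toℕ p < t) → StepAt t (pB p)
    ownMove (no p≮t) = firstMove (target p) refl
      (≤-antisym (≮⇒≥ p≮t) (≤-trans (≤-reflexive p≡ph) (m%n≤m t period)))
    -- p has moved before, so t lies beyond the first period.
    ownMove (yes p<t) = move (stay∈δB (target p)) (bState-moved p<t)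
      (twinGuard (trans (bState-settled 2k≤t (twin p)) (target-twin p)))
      (bState-moved (m<n⇒m<1+n p<t))
      where
      2k≤t : 2 * k ≤ t
      2k≤t = <⇒≤ (<-≤-trans 2k<period (≮⇒≥ λ t<period → <⇒≢ p<t (trans p≡ph (m<n⇒m%n≡m t<period))))

  aTurn : ∀ t d → phase t ≡ 2 * k + d → d ≤ k → StepAt t pA
  aTurn t d ph≡2k+d d≤k = climbOrReset (m≤n⇒m<n∨m≡n d≤k)
    where
    2k≤t : 2 * k ≤ t
    2k≤t = ≤-trans (m≤m+n (2 * k) d) (≤-trans (≤-reflexive (sym ph≡2k+d)) (m%n≤m t period))

    1+ph≡2k+1+d : suc (phase t) ≡ 2 * k + suc d
    1+ph≡2k+1+d = trans (cong suc ph≡2k+d) (sym (+-suc (2 * k) d))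

    others : ∀ q → bState q (suc t) ≡ bState q t
    others q = bState-frame (<⇒≢ (<-≤-trans (toℕ<n q) 2k≤t))

    move : ∀ {q g q′} → (q , zero , g , q′) ∈ δA → aState t ≡ q →
           GuardOK templates (state t) pA g → aState (suc t) ≡ q′ → StepAt t pA
    move t∈δA before guard after = stepA t∈δA before refl guard after others

    climbOrReset : d < k ⊎ d ≡ k → StepAt t pA
    climbOrReset (inj₁ d<k) = move (climb∈δA a) before guard after
      where
      a = fromℕ< d<k

      before : aState t ≡ inject₁ a
      before = toℕ-injective (trans (aState-at t d ph≡2k+d)
                                    (sym (trans (toℕ-inject₁ a) (toℕ-fromℕ< d<k))))

      guard : GuardOK templates (state t) pA (occupiedBy a)
      guard = occupiedBy⁺ (combine {2} zero a) (λ ())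
                (trans (bState-settled 2k≤t (combine {2} zero a))
                       (cong proj₂ (remQuot-combine {2} zero a)))

      after : aState (suc t) ≡ suc a
      after = toℕ-injective (trans (aState-at (suc t) (suc d) ph′≡2k+1+d)
                                   (cong suc (sym (toℕ-fromℕ< d<k))))
        where
        1+ph<period : suc (phase t) < period
        1+ph<period = subst (_< period) (sym 1+ph≡2k+1+d) (+-monoʳ-< (2 * k) (s≤s d<k))

        ph′≡2k+1+d : phase (suc t) ≡ 2 * k + suc d
        ph′≡2k+1+d = trans ([1+m]%n≡1+[m%n] t period 1+ph<period) 1+ph≡2k+1+d
    climbOrReset (inj₂ d≡k) = move reset∈δA before (pB zero , (λ ()) , refl) after
      where
      before : aState t ≡ fromℕ k
      before = toℕ-injective (trans (aState-at t d ph≡2k+d) (trans d≡k (sym (toℕ-fromℕ k))))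

      after : aState (suc t) ≡ zero
      after = aState-home (suc t) (subst (_≤ 2 * k)
                (sym ([1+m]%n≡0 t period (trans 1+ph≡2k+1+d (cong (λ x → 2 * k + suc x) d≡k)))) z≤n)

  stepAt : ∀ t → StepAt t (mover t)
  stepAt t with phase t <? 2 * k
  ... | yes ph<2k = bTurn t (fromℕ< ph<2k) (toℕ-fromℕ< ph<2k)
  ... | no  ph≮2k = aTurn t (phase t ∸ 2 * k) (sym (m+[n∸m]≡n (≮⇒≥ ph≮2k)))
                      (≤-pred (m<n+o⇒m∸n<o (phase t) (2 * k) (m%n<n t period)))

  mover-B : ∀ t p → toℕ p ≡ phase t → mover t ≡ pB p
  mover-B t p p≡ph with phase t <? 2 * k
  ... | yes ph<2k = cong pB (toℕ-injective (trans (toℕ-fromℕ< ph<2k) (sym p≡ph)))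
  ... | no  ph≮2k = contradiction (subst (_< 2 * k) p≡ph (toℕ<n p)) ph≮2k

  mover-A : ∀ t → 2 * k ≤ phase t → mover t ≡ pA
  mover-A t 2k≤ph with phase t <? 2 * k
  ... | yes ph<2k = contradiction 2k≤ph (<⇒≱ ph<2k)
  ... | no  _     = refl

  twinRun : Run templates (2 * k)
  twinRun = record
    { st = state ; inp = λ _ → input ; mv = mover
    ; initialA = aState-home 0 z≤n
    ; initialB = λ p → bState-fresh {p} z≤n
    ; step = stepAt
    ; inputA = λ _ _ → refl
    ; inputB = λ _ _ _ → refl }

  twinRun-fair : UncondFair templates twinRun
  twinRun-fair pA t = let t′ , t≤t′ , ph≡2k = %-recurs 2k<period t in
    t′ , t≤t′ , mover-A t′ (≤-reflexive (sym ph≡2k))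
  twinRun-fair (pB p) t = let t′ , t≤t′ , ph≡p = %-recurs (<-trans (toℕ<n p) 2k<period) t in
    t′ , t≤t′ , mover-B t′ p (sym ph≡p)

  twinRun-recurs : label templates twinRun , 0 ⊨ everyAStateRecurs
  twinRun-recurs = ⊨⋀⁺ (label templates twinRun) 0 (λ a → □◇ atom (stateA a)) λ a →
    ⊨□◇⁺ (label templates twinRun) 0 (atom (stateA a)) λ t →
    let t′ , t≤t′ , ph≡2k+a = %-recurs (+-monoʳ-< (2 * k) (toℕ<n a)) t in
    t′ , t≤t′ , toℕ-injective (aState-at t′ (toℕ a) ph≡2k+a)

  fairRunAt2k : EUncond templates (2 * k) everyAStateRecurs
  fairRunAt2k = twinRun , twinRun-fair , twinRun-recurs

mainTheorem5 : ∀ (k : ℕ) → 1 ≤ k →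
    ∃ λ (T : Templates) → Templates.nQB T ≡ k ×
      ∃ λ (h : LTL (AP T)) →
        EUncond T (2 * Templates.nQB T) h × ¬ EUncond T (2 * Templates.nQB T ∸ 1) h
mainTheorem5 zero    ()
-- ≤-refl proves 2 * k ∸ 1 < 2 * k because 2 * suc m reduces to a successor.
mainTheorem5 (suc m) _ = templates , refl , everyAStateRecurs , fairRunAt2k , noFairRunBelow ≤-refl
  where open Construction m
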